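{- A position $(n_0,n_1,n_2,n_3,n_4,n_5)$ of ${\rm ECN}(6_{\{1,2\}},2)$ is a $\mathcal{P}$-position if and only if $n_0\oplus n_3 = n_1\oplus n_4 = n_2\oplus n_5$.
   Context: Extended circular nim ${\rm ECN}(m_S,k)$ (positive integers $k\le m$, $S$ a set of positive integers each at most $m/2$): there are $m$ piles $v_0,\dots,v_{m-1}$ arranged in a circle (indices mod $m$); a position is a tuple $(n_0,\dots,n_{m-1})$ of nonnegative integers, $n_i$ being the number of tokens on $v_i$. A move chooses $s\in S$, $i\in\{0,\dots,m-1\}$, $j\in\{0,\dots,k-1\}$ and removes an arbitrary nonnegative number of tokens from each pile $v_{(i+ts)\bmod m}$, $t=0,\dots,j$, removing at least one token in total (empty piles still count as piles). Normal play: the player unable to move loses. A $\mathcal{P}$-position is a position from which the previous player (the player who just moved) has a winning strategy. $\oplus$ denotes bitwise exclusive OR of binary expansions (nim-sum). -}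

module Defs where

open import Data.Nat using (ℕ; zero; suc; _+_; _*_; _≤_; _<_; _≡ᵇ_; NonZero)
open import Data.Nat.DivMod using (_%_; _/_)
open import Data.Bool using (Bool; true; false; _xor_; if_then_else_)
open import Data.Fin using (Fin; toℕ)
open import Data.List using (List)
open import Data.List.Membership.Propositional using (_∈_)
open import Data.Product using (Σ; ∃; _×_; _,_)
open import Relation.Binary.PropositionalEquality using (_≡_)
open import Relation.Nullary using (¬_)

-- Nim-sum (bitwise XOR of binary expansions).
-- xorFuel f a b computes the XOR of the lowest f bits of a and b;
-- since a number a has at most a binary digits, fuel a + b suffices.

oddᵇ : ℕ → Bool
oddᵇ n = (n % 2) ≡ᵇ 1

xorFuel : ℕ → ℕ → ℕ → ℕ
xorFuel zero    a b = 0
xorFuel (suc f) a b =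
  (if oddᵇ a xor oddᵇ b then 1 else 0) + 2 * xorFuel f (a / 2) (b / 2)

infixl 6 _⊕_
_⊕_ : ℕ → ℕ → ℕ
a ⊕ b = xorFuel (a + b) a b

Position : ℕ → Set
Position m = Fin m → ℕ

Affected : (m : ℕ) → .{{NonZero m}} → (s : ℕ) → Fin m → ℕ → Fin m → Set
Affected m s i j l = ∃ λ t → t ≤ j × toℕ l ≡ (toℕ i + t * s) % m

Move : (m : ℕ) → .{{NonZero m}} → List ℕ → ℕ → Position m → Position m → Set
Move m S k p q =
  Σ ℕ λ s → s ∈ S × Σ (Fin m) λ i → Σ ℕ λ j → j < k ×
    ((∀ l → q l ≤ p l) ×
     (∀ l → ¬ Affected m s i j l → q l ≡ p l) ×
     (∃ λ l → q l < p l))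

-- P-positions (previous player wins) and N-positions (next player wins)
-- under normal play, defined inductively (the game is finite).
mutual
  data IsP (m : ℕ) .{{_ : NonZero m}} (S : List ℕ) (k : ℕ) (p : Position m) : Set where
    allMovesToN : (∀ q → Move m S k p q → IsN m S k q) → IsP m S k p

  data IsN (m : ℕ) .{{_ : NonZero m}} (S : List ℕ) (k : ℕ) (p : Position m) : Set where
    someMoveToP : (q : Position m) → Move m S k p q → IsP m S k q → IsN m S k p

{-# OPTIONS --safe #-}
-- Group the piles into the three opposite pairs {v_r, v_{r+3}} and let X_r be the nim-sum of
-- pair r. A move changes only v_i and v_{i+s} with s ∈ {1, 2}, which lie in different pairs, so
-- it leaves one pair untouched and changes at most one pile of every pair. If X_0 = X_1 = X_2
-- holds before and after a move, the untouched pair fixes the common value, and cancellation of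
-- nim-sums forces the changed piles back to their old sizes. If the X_r are not all equal, let X_r
-- be the least one; by the basic lemma of Nim each other pair reaches nim-sum X_r by lowering one of
-- its piles, and piles of different pairs are at circular distance 1 or 2, so both reductions form
-- a single move. The positions with equal X_r are thus independent and absorbing in the
-- well-founded move graph, which makes them exactly the P-positions.
module Submission where

open import Data.Bool using (Bool; true; false; _xor_; if_then_else_)
open import Data.Bool.Properties using (xor-comm; xor-assoc; xor-same; xor-identityʳ)
open import Data.Fin using (Fin; toℕ; zero; suc; _↑ˡ_)
open import Data.Fin.Patterns using (0F; 1F; 2F; 3F; 4F; 5F)
open import Data.Fin.Properties using (toℕ-injective; toℕ-fromℕ<; toℕ<n) renaming (_≟_ to _≟ᶠ_)
open import Data.List using (List; _∷_; [])
open import Data.List.Membership.Propositional using (_∈_)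
open import Data.List.Relation.Unary.Any using (here; there)
open import Data.Nat using (ℕ; zero; suc; _+_; _*_; _≤_; _<_; _≡ᵇ_; z≤n; s≤s; NonZero)
open import Data.Nat.DivMod
open import Data.Nat.Divisibility using (m∣m*n)
open import Data.Nat.Induction using (<-wellFounded)
open import Data.Nat.Properties
open import Data.Product using (∃; ∃₂; _×_; _,_; proj₁; proj₂)
open import Data.Sum using (_⊎_; inj₁; inj₂) renaming (map to ⊎-map)
open import Data.Vec using (_∷_; []; lookup)
open import Data.Vec.Functional using (updateAt)
open import Data.Vec.Functional.Properties using (updateAt-updates; updateAt-minimal)
open import Function using (_∘_; const)
open import Function.Bundles using (_⇔_; mk⇔)
open import Induction.WellFounded using (Acc; acc)
open import Relation.Binary.Definitions using (tri<; tri≈; tri>)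
open import Relation.Binary.PropositionalEquality
open import Relation.Nullary using (¬_; Dec; yes; no; contradiction)
open import Relation.Nullary.Decidable using (decidable-stable; _⊎-dec_; _×-dec_)
open import Relation.Unary using (Decidable)

open import Defs

open ≡-Reasoning

-- Binary digits and nim-sums

-- Written with if_then_else_ so that the step of xorFuel is definitionally a _∷ᵇ_.
bit : Bool → ℕ
bit b = if b then 1 else 0

bit<2 : ∀ b → bit b < 2
bit<2 true  = s≤s (s≤s z≤n)
bit<2 false = s≤s z≤n

bit-<-inv : ∀ {b c} → bit b < bit c → b ≡ false × c ≡ true
bit-<-inv {false} {true} _ = refl , refl
bit-<-inv {false} {false} ()
bit-<-inv {true}  {false} ()
bit-<-inv {true}  {true}  (s≤s ())

infixr 5 _∷ᵇ_
_∷ᵇ_ : Bool → ℕ → ℕ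
b ∷ᵇ n = bit b + 2 * n

[2*n]/2≡n : ∀ n → 2 * n / 2 ≡ n
[2*n]/2≡n n = trans (cong (_/ 2) (*-comm 2 n)) (m*n/n≡m n 2)

∷ᵇ-half : ∀ b n → (b ∷ᵇ n) / 2 ≡ n
∷ᵇ-half b n = begin
  (bit b + 2 * n) / 2     ≡⟨ +-distrib-/-∣ʳ (bit b) (m∣m*n n) ⟩
  bit b / 2 + 2 * n / 2   ≡⟨ cong₂ _+_ (m<n⇒m/n≡0 (bit<2 b)) ([2*n]/2≡n n) ⟩
  n                       ∎

oddᵇ-∷ᵇ : ∀ b n → oddᵇ (b ∷ᵇ n) ≡ b
oddᵇ-∷ᵇ b n = begin
  (bit b + 2 * n) % 2 ≡ᵇ 1  ≡⟨ cong (λ x → (bit b + x) % 2 ≡ᵇ 1) (*-comm 2 n) ⟩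
  (bit b + n * 2) % 2 ≡ᵇ 1  ≡⟨ cong (_≡ᵇ 1) ([m+kn]%n≡m%n (bit b) n 2) ⟩
  bit b % 2 ≡ᵇ 1            ≡⟨ lowest b ⟩
  b                         ∎
  where
  lowest : ∀ b → (bit b % 2 ≡ᵇ 1) ≡ b
  lowest true  = refl
  lowest false = refl

oddᵇ∷ᵇhalf : ∀ n → oddᵇ n ∷ᵇ n / 2 ≡ n
oddᵇ∷ᵇhalf n = begin
  bit (n % 2 ≡ᵇ 1) + 2 * (n / 2)  ≡⟨ cong₂ _+_ (bit-≡ᵇ1 (m%n<n n 2)) (*-comm 2 (n / 2)) ⟩
  n % 2 + n / 2 * 2               ≡⟨ m≡m%n+[m/n]*n n 2 ⟨
  n                               ∎
  where
  bit-≡ᵇ1 : ∀ {r} → r < 2 → bit (r ≡ᵇ 1) ≡ r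
  bit-≡ᵇ1 {0} _ = refl
  bit-≡ᵇ1 {1} _ = refl
  bit-≡ᵇ1 {suc (suc _)} (s≤s (s≤s ()))

∷ᵇ-injective : ∀ b c n m → b ∷ᵇ n ≡ c ∷ᵇ m → b ≡ c × n ≡ m
∷ᵇ-injective b c n m eq =
  trans (sym (oddᵇ-∷ᵇ b n)) (trans (cong oddᵇ eq) (oddᵇ-∷ᵇ c m)) ,
  trans (sym (∷ᵇ-half b n)) (trans (cong (_/ 2) eq) (∷ᵇ-half c m))

∷ᵇ-mono-< : ∀ {n m} b c → n < m → b ∷ᵇ n < c ∷ᵇ m
∷ᵇ-mono-< {n} {m} b c n<m =
  <-≤-trans (+-monoˡ-< (2 * n) (bit<2 b))
    (≤-trans (≤-reflexive (sym (*-suc 2 n)))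
      (≤-trans (*-monoʳ-≤ 2 n<m) (m≤n+m (2 * m) (bit c))))

∷ᵇ-<-inv : ∀ b c n m → b ∷ᵇ n < c ∷ᵇ m → n < m ⊎ (n ≡ m × b ≡ false × c ≡ true)
∷ᵇ-<-inv b c n m lt with <-cmp n m
... | tri< n<m _ _ = inj₁ n<m
... | tri> _ _ m<n = contradiction lt (<-asym (∷ᵇ-mono-< c b m<n))
... | tri≈ _ refl _ = inj₂ (refl , bit-<-inv (+-cancelʳ-< (2 * n) (bit b) (bit c) lt))

xor-involutiveʳ : ∀ a b → (a xor b) xor b ≡ a
xor-involutiveʳ a b = begin
  (a xor b) xor b  ≡⟨ xor-assoc a b b ⟩
  a xor (b xor b)  ≡⟨ cong (a xor_) (xor-same b) ⟩
  a xor false      ≡⟨ xor-identityʳ a ⟩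
  a                ∎

xor-cancelʳ : ∀ {a b} c → a xor c ≡ b xor c → a ≡ b
xor-cancelʳ {a} {b} c eq = begin
  a                ≡⟨ xor-involutiveʳ a c ⟨
  (a xor c) xor c  ≡⟨ cong (_xor c) eq ⟩
  (b xor c) xor c  ≡⟨ xor-involutiveʳ b c ⟩
  b                ∎

x*2≤1+f⇒x≤f : ∀ x f → x * 2 ≤ suc f → x ≤ f
x*2≤1+f⇒x≤f zero    f       _               = z≤n
x*2≤1+f⇒x≤f (suc x) (suc f) (s≤s (s≤s le)) = s≤s (x*2≤1+f⇒x≤f x f (m≤n⇒m≤1+n le))

halves-≤ : ∀ a b {f} → a + b ≤ suc f → a / 2 + b / 2 ≤ f
halves-≤ a b {f} a+b≤1+f = x*2≤1+f⇒x≤f (a / 2 + b / 2) f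
  (≤-trans (≤-reflexive (*-distribʳ-+ 2 (a / 2) (b / 2)))
    (≤-trans (+-mono-≤ (m/n*n≤m a 2) (m/n*n≤m b 2)) a+b≤1+f))

xorFuel-zero : ∀ f → xorFuel f 0 0 ≡ 0
xorFuel-zero zero    = refl
xorFuel-zero (suc f) = cong (2 *_) (xorFuel-zero f)

xorFuel-irrelevant : ∀ {f g} a b → a + b ≤ f → a + b ≤ g → xorFuel f a b ≡ xorFuel g a b
xorFuel-irrelevant {zero}  {g}     zero    zero    _  _  = sym (xorFuel-zero g)
xorFuel-irrelevant {suc f} {zero}  zero    zero    _  _  = xorFuel-zero (suc f)
xorFuel-irrelevant {suc f} {suc g} a       b       h₁ h₂ =
  cong ((oddᵇ a xor oddᵇ b) ∷ᵇ_) (xorFuel-irrelevant (a / 2) (b / 2) (halves-≤ a b h₁) (halves-≤ a b h₂))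

⊕-unfold : ∀ a b → a ⊕ b ≡ (oddᵇ a xor oddᵇ b) ∷ᵇ (a / 2 ⊕ b / 2)
⊕-unfold a b = begin
  xorFuel (a + b) a b        ≡⟨ xorFuel-irrelevant a b ≤-refl (n≤1+n (a + b)) ⟩
  xorFuel (suc (a + b)) a b  ≡⟨ cong ((oddᵇ a xor oddᵇ b) ∷ᵇ_) (xorFuel-irrelevant (a / 2) (b / 2) (halves-≤ a b (n≤1+n (a + b))) ≤-refl) ⟩
  (oddᵇ a xor oddᵇ b) ∷ᵇ (a / 2 ⊕ b / 2)  ∎

xorFuel-comm : ∀ f a b → xorFuel f a b ≡ xorFuel f b a
xorFuel-comm zero    a b = refl
xorFuel-comm (suc f) a b = cong₂ _∷ᵇ_ (xor-comm (oddᵇ a) (oddᵇ b)) (xorFuel-comm f (a / 2) (b / 2))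

⊕-comm : ∀ a b → a ⊕ b ≡ b ⊕ a
⊕-comm a b = trans (xorFuel-comm (a + b) a b) (cong (λ f → xorFuel f b a) (+-comm a b))

halving-induction : (P : ℕ → ℕ → Set) → P 0 0 → (∀ a b → P (a / 2) (b / 2) → P a b) →
                    ∀ a b → P a b
halving-induction P base step a b = go (a + b) a b ≤-refl
  where
  go : ∀ f a b → a + b ≤ f → P a b
  go zero    zero    zero    _   = base
  go zero    zero    (suc _) ()
  go zero    (suc _) _       ()
  go (suc f) a       b       a+b≤ = step a b (go f (a / 2) (b / 2) (halves-≤ a b a+b≤))

∷ᵇ-⊕ : ∀ b n y → (b ∷ᵇ n) ⊕ y ≡ (b xor oddᵇ y) ∷ᵇ (n ⊕ y / 2)
∷ᵇ-⊕ b n y = trans (⊕-unfold (b ∷ᵇ n) y)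
  (cong₂ (λ c m → (c xor oddᵇ y) ∷ᵇ (m ⊕ y / 2)) (oddᵇ-∷ᵇ b n) (∷ᵇ-half b n))

⊕-cancelʳ : ∀ c {a b} → a ⊕ c ≡ b ⊕ c → a ≡ b
⊕-cancelʳ c {a} {b} = halving-induction (λ a b → ∀ c → a ⊕ c ≡ b ⊕ c → a ≡ b) (λ _ _ → refl) step a b c
  where
  step : ∀ a b → (∀ c → a / 2 ⊕ c ≡ b / 2 ⊕ c → a / 2 ≡ b / 2) → ∀ c → a ⊕ c ≡ b ⊕ c → a ≡ b
  step a b ih c eq
    with ∷ᵇ-injective (oddᵇ a xor oddᵇ c) (oddᵇ b xor oddᵇ c) (a / 2 ⊕ c / 2) (b / 2 ⊕ c / 2)
           (trans (sym (⊕-unfold a c)) (trans eq (⊕-unfold b c)))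
  ... | same-bit , same-rest = begin
    a                ≡⟨ oddᵇ∷ᵇhalf a ⟨
    oddᵇ a ∷ᵇ a / 2  ≡⟨ cong₂ _∷ᵇ_ (xor-cancelʳ {oddᵇ a} {oddᵇ b} (oddᵇ c) same-bit) (ih (c / 2) same-rest) ⟩
    oddᵇ b ∷ᵇ b / 2  ≡⟨ oddᵇ∷ᵇhalf b ⟩
    b                ∎

Lowering : ℕ → ℕ → ℕ → Set
Lowering x y t = ∃ λ x′ → x′ < x × x′ ⊕ y ≡ t

lowering-from-halves : ∀ {x y t} → Lowering (x / 2) (y / 2) (t / 2) → Lowering x y t
lowering-from-halves {x} {y} {t} (x′ , x′<x/2 , x′⊕y/2≡t/2) = b ∷ᵇ x′ , lower , nim-sum
  where
  b = oddᵇ t xor oddᵇ y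
  lower : b ∷ᵇ x′ < x
  lower = subst (b ∷ᵇ x′ <_) (oddᵇ∷ᵇhalf x) (∷ᵇ-mono-< b (oddᵇ x) x′<x/2)
  nim-sum : (b ∷ᵇ x′) ⊕ y ≡ t
  nim-sum = begin
    (b ∷ᵇ x′) ⊕ y                ≡⟨ ∷ᵇ-⊕ b x′ y ⟩
    (b xor oddᵇ y) ∷ᵇ (x′ ⊕ y / 2)  ≡⟨ cong₂ _∷ᵇ_ (xor-involutiveʳ (oddᵇ t) (oddᵇ y)) x′⊕y/2≡t/2 ⟩
    oddᵇ t ∷ᵇ t / 2              ≡⟨ oddᵇ∷ᵇhalf t ⟩
    t                            ∎

lowering-clear-bit : ∀ {x y} → oddᵇ x ≡ true → oddᵇ y ≡ false →
                     Lowering x y (false ∷ᵇ (x / 2 ⊕ y / 2))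
lowering-clear-bit {x} {y} x-odd y-even = false ∷ᵇ x / 2 , lower , nim-sum
  where
  lower : false ∷ᵇ x / 2 < x
  lower = subst (false ∷ᵇ x / 2 <_) (trans (cong (_∷ᵇ x / 2) (sym x-odd)) (oddᵇ∷ᵇhalf x)) ≤-refl
  nim-sum : (false ∷ᵇ x / 2) ⊕ y ≡ false ∷ᵇ (x / 2 ⊕ y / 2)
  nim-sum = trans (∷ᵇ-⊕ false (x / 2) y) (cong (_∷ᵇ (x / 2 ⊕ y / 2)) y-even)

⊕-lowering : ∀ x y t → t < x ⊕ y → Lowering x y t ⊎ Lowering y x t
⊕-lowering = halving-induction (λ x y → ∀ t → t < x ⊕ y → Lowering x y t ⊎ Lowering y x t) (λ _ ()) step
  where
  step : ∀ x y → (∀ t → t < x / 2 ⊕ y / 2 → Lowering (x / 2) (y / 2) t ⊎ Lowering (y / 2) (x / 2) t) →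
         ∀ t → t < x ⊕ y → Lowering x y t ⊎ Lowering y x t
  -- Either t and x ⊕ y differ above the lowest bit, or t is x ⊕ y with its lowest bit cleared.
  step x y ih t t<x⊕y
    with ∷ᵇ-<-inv (oddᵇ t) (oddᵇ x xor oddᵇ y) (t / 2) (x / 2 ⊕ y / 2)
           (subst₂ _<_ (sym (oddᵇ∷ᵇhalf t)) (⊕-unfold x y) t<x⊕y)
  ... | inj₁ t/2< = ⊎-map lowering-from-halves lowering-from-halves (ih (t / 2) t/2<)
  ... | inj₂ (t/2≡ , t-even , odd-sum) with oddᵇ x in x-odd | oddᵇ y in y-odd | odd-sum
  ...   | true  | false | _ = inj₁ (subst (Lowering x y) t≡ (lowering-clear-bit x-odd y-odd))
    where
    t≡ : false ∷ᵇ (x / 2 ⊕ y / 2) ≡ t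
    t≡ = trans (cong₂ _∷ᵇ_ (sym t-even) (sym t/2≡)) (oddᵇ∷ᵇhalf t)
  ...   | false | true  | _ = inj₂ (subst (Lowering y x) t≡ (lowering-clear-bit y-odd x-odd))
    where
    t≡ : false ∷ᵇ (y / 2 ⊕ x / 2) ≡ t
    t≡ = trans (cong₂ _∷ᵇ_ (sym t-even) (trans (⊕-comm (y / 2) (x / 2)) (sym t/2≡))) (oddᵇ∷ᵇhalf t)

-- Moves and P-positions of extended circular nim

tokens : ∀ {n} → (Fin n → ℕ) → ℕ
tokens {zero}  p = 0
tokens {suc n} p = p zero + tokens (p ∘ suc)

tokens-mono-≤ : ∀ {n} {p q : Fin n → ℕ} → (∀ l → q l ≤ p l) → tokens q ≤ tokens p
tokens-mono-≤ {zero}  q≤p = z≤n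
tokens-mono-≤ {suc n} q≤p = +-mono-≤ (q≤p zero) (tokens-mono-≤ (q≤p ∘ suc))

tokens-mono-< : ∀ {n} {p q : Fin n → ℕ} → (∀ l → q l ≤ p l) → ∃ (λ l → q l < p l) → tokens q < tokens p
tokens-mono-< q≤p (zero  , q<p) = +-mono-<-≤ q<p (tokens-mono-≤ (q≤p ∘ suc))
tokens-mono-< q≤p (suc l , q<p) = +-mono-≤-< (q≤p zero) (tokens-mono-< (q≤p ∘ suc) (l , q<p))

module TwoPileUpdate {n} (p : Fin n → ℕ) {w₁ w₂ : Fin n} (w₁≢w₂ : w₁ ≢ w₂) (z₁ z₂ : ℕ) where

  updated : Fin n → ℕ
  updated = updateAt (updateAt p w₁ (const z₁)) w₂ (const z₂)

  updated-w₁ : updated w₁ ≡ z₁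
  updated-w₁ = trans (updateAt-minimal w₁ w₂ _ w₁≢w₂) (updateAt-updates w₁ p)

  updated-w₂ : updated w₂ ≡ z₂
  updated-w₂ = updateAt-updates w₂ _

  updated-elsewhere : ∀ {u} → u ≢ w₁ → u ≢ w₂ → updated u ≡ p u
  updated-elsewhere {u} u≢w₁ u≢w₂ = trans (updateAt-minimal u w₂ _ u≢w₂) (updateAt-minimal u w₁ p u≢w₁)

  updated-≤ : z₁ ≤ p w₁ → z₂ ≤ p w₂ → ∀ u → updated u ≤ p u
  updated-≤ z₁≤ z₂≤ u with u ≟ᶠ w₁ | u ≟ᶠ w₂
  ... | yes refl | _        = subst (_≤ p u) (sym updated-w₁) z₁≤
  ... | no _     | yes refl = subst (_≤ p u) (sym updated-w₂) z₂≤
  ... | no u≢w₁  | no u≢w₂  = ≤-reflexive (updated-elsewhere u≢w₁ u≢w₂)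

module _ {m : ℕ} .{{_ : NonZero m}} {S : List ℕ} {k : ℕ} where

  Move⇒tokens< : ∀ {p q} → Move m S k p q → tokens q < tokens p
  Move⇒tokens< (_ , _ , _ , _ , _ , q≤p , _ , decrease) = tokens-mono-< q≤p decrease

  two-pile-move : ∀ {p s i j w₁ w₂ z₁ z₂} (w₁≢w₂ : w₁ ≢ w₂) → s ∈ S → j < k →
                  Affected m s i j w₁ → Affected m s i j w₂ → z₁ ≤ p w₁ → z₂ ≤ p w₂ →
                  z₁ < p w₁ ⊎ z₂ < p w₂ → Move m S k p (TwoPileUpdate.updated p w₁≢w₂ z₁ z₂)
  two-pile-move {p} {s} {i} {j} {w₁} {w₂} {z₁} {z₂} w₁≢w₂ s∈ j<k w₁-affected w₂-affected z₁≤ z₂≤ strict =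
    s , s∈ , i , j , j<k , updated-≤ z₁≤ z₂≤ , unaffected , decrease strict
    where
    open TwoPileUpdate p w₁≢w₂ z₁ z₂
    unaffected : ∀ u → ¬ Affected m s i j u → updated u ≡ p u
    unaffected u u∉ = updated-elsewhere (λ { refl → u∉ w₁-affected }) (λ { refl → u∉ w₂-affected })
    decrease : z₁ < p w₁ ⊎ z₂ < p w₂ → ∃ λ u → updated u < p u
    decrease (inj₁ z₁<) = w₁ , subst (_< p w₁) (sym updated-w₁) z₁<
    decrease (inj₂ z₂<) = w₂ , subst (_< p w₂) (sym updated-w₂) z₂<

  IsP⇒¬IsN : ∀ {p} → IsP m S k p → ¬ IsN m S k p
  IsP⇒¬IsN (allMovesToN toN) (someMoveToP q move isP) = IsP⇒¬IsN isP (toN q move)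

  IsP⇔kernel : (K : Position m → Set) → Decidable K →
               (∀ {p q} → Move m S k p q → K p → ¬ K q) →
               (∀ p → ¬ K p → ∃ λ q → Move m S k p q × K q) →
               ∀ p → IsP m S k p ⇔ K p
  IsP⇔kernel K K? independent absorbing p =
    mk⇔ (λ P → decidable-stable (K? p) (IsP⇒¬IsN P ∘ proj₂ classified)) (proj₁ classified)
    where
    classify : ∀ p → Acc _<_ (tokens p) → (K p → IsP m S k p) × (¬ K p → IsN m S k p)
    classify p (acc smaller) = isP , isN
      where
      isP : K p → IsP m S k p
      isP Kp = allMovesToN λ q move → proj₂ (classify q (smaller (Move⇒tokens< move))) (independent move Kp)
      isN : ¬ K p → IsN m S k p
      isN ¬Kp with absorbing p ¬Kp
      ... | q , move , Kq = someMoveToP q move (proj₁ (classify q (smaller (Move⇒tokens< move))) Kq)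

    classified : (K p → IsP m S k p) × (¬ K p → IsN m S k p)
    classified = classify p (<-wellFounded (tokens p))

infixl 6 _⊹_
_⊹_ : ∀ {m} .{{_ : NonZero m}} → Fin m → ℕ → Fin m
_⊹_ {m} i s = (toℕ i + s) mod m

module _ {m : ℕ} .{{_ : NonZero m}} where

  Window : ℕ → Fin m → Fin m → Set
  Window s i u = u ≡ i ⊎ u ≡ i ⊹ s

  [toℕi+0]%m≡toℕi : ∀ i → (toℕ i + 0) % m ≡ toℕ i
  [toℕi+0]%m≡toℕi i = trans (cong (_% m) (+-identityʳ (toℕ i))) (m<n⇒m%n≡m (toℕ<n i))

  toℕ-⊹ : ∀ i s → toℕ (i ⊹ s) ≡ (toℕ i + 1 * s) % m
  toℕ-⊹ i s = trans (toℕ-fromℕ< _) (cong (λ x → (toℕ i + x) % m) (sym (*-identityˡ s)))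

  affected⇒window : ∀ {s i j u} → j < 2 → Affected m s i j u → Window s i u
  affected⇒window {i = i}     _   (0 , _ , u≡) = inj₁ (toℕ-injective (trans u≡ ([toℕi+0]%m≡toℕi i)))
  affected⇒window {s} {i}     _   (1 , _ , u≡) = inj₂ (toℕ-injective (trans u≡ (sym (toℕ-⊹ i s))))
  affected⇒window             j<2 (suc (suc _) , t≤j , _) =
    contradiction (<-≤-trans j<2 (s≤s (s≤s z≤n))) (≤⇒≯ t≤j)

  window⇒affected : ∀ {s i u} → Window s i u → Affected m s i 1 u
  window⇒affected     {i = i} (inj₁ refl) = 0 , z≤n , sym ([toℕi+0]%m≡toℕi i)
  window⇒affected {s} {i}     (inj₂ refl) = 1 , s≤s z≤n , toℕ-⊹ i s

  window? : ∀ s i u → Dec (Window s i u)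
  window? s i u = (u ≟ᶠ i) ⊎-dec (u ≟ᶠ i ⊹ s)

-- The game ECN(6_{1,2}, 2)

S₁₂ : List ℕ
S₁₂ = 1 ∷ 2 ∷ []

opposite : Fin 6 → Fin 6
opposite l = l ⊹ 3

pair : Fin 6 → Fin 3
pair l = toℕ l mod 3

next : Fin 3 → Fin 3
next r = r ⊹ 1

data InPair (r : Fin 3) : Fin 6 → Set where
  lower : InPair r (r ↑ˡ 3)
  upper : InPair r (opposite (r ↑ˡ 3))

pairNimSum : Position 6 → Fin 3 → ℕ
pairNimSum p r = p (r ↑ˡ 3) ⊕ p (opposite (r ↑ˡ 3))

Balanced : Position 6 → Set
Balanced p = pairNimSum p 0F ≡ pairNimSum p 1F × pairNimSum p 1F ≡ pairNimSum p 2F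

balanced? : ∀ p → Dec (Balanced p)
balanced? p = (pairNimSum p 0F ≟ pairNimSum p 1F) ×-dec (pairNimSum p 1F ≟ pairNimSum p 2F)

opposite-involutive : ∀ l → opposite (opposite l) ≡ l
opposite-involutive 0F = refl
opposite-involutive 1F = refl
opposite-involutive 2F = refl
opposite-involutive 3F = refl
opposite-involutive 4F = refl
opposite-involutive 5F = refl

opposite-≢ : ∀ l → opposite l ≢ l
opposite-≢ 0F ()
opposite-≢ 1F ()
opposite-≢ 2F ()
opposite-≢ 3F ()
opposite-≢ 4F ()
opposite-≢ 5F ()

pair-opposite : ∀ l → pair (opposite l) ≡ pair l
pair-opposite 0F = refl
pair-opposite 1F = refl
pair-opposite 2F = refl
pair-opposite 3F = refl
pair-opposite 4F = refl
pair-opposite 5F = refl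

inPair : ∀ l → InPair (pair l) l
inPair 0F = lower
inPair 1F = lower
inPair 2F = lower
inPair 3F = upper
inPair 4F = upper
inPair 5F = upper

pair-↑ˡ : ∀ r → pair (r ↑ˡ 3) ≡ r
pair-↑ˡ 0F = refl
pair-↑ˡ 1F = refl
pair-↑ˡ 2F = refl

InPair⇒pair : ∀ {r w} → InPair r w → pair w ≡ r
InPair⇒pair {r} lower = pair-↑ˡ r
InPair⇒pair {r} upper = trans (pair-opposite (r ↑ˡ 3)) (pair-↑ˡ r)

InPair-opposite : ∀ {r w} → InPair r w → InPair r (opposite w)
InPair-opposite lower = upper
InPair-opposite {r} upper = subst (InPair r) (sym (opposite-involutive (r ↑ˡ 3))) lower

InPair-apart : ∀ {r₁ r₂ u v} → InPair r₁ u → InPair r₂ v → r₁ ≢ r₂ → u ≢ v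
InPair-apart u∈ v∈ r₁≢r₂ refl = r₁≢r₂ (trans (sym (InPair⇒pair u∈)) (InPair⇒pair v∈))

pairNimSum-InPair : ∀ p {r w} → InPair r w → pairNimSum p r ≡ p w ⊕ p (opposite w)
pairNimSum-InPair p lower = refl
pairNimSum-InPair p {r} upper = begin
  p w ⊕ p (opposite w)                      ≡⟨ ⊕-comm (p w) (p (opposite w)) ⟩
  p (opposite w) ⊕ p w                      ≡⟨ cong (λ v → p (opposite w) ⊕ p v) (opposite-involutive w) ⟨
  p (opposite w) ⊕ p (opposite (opposite w)) ∎
  where w = r ↑ˡ 3

next-≢ : ∀ r → next r ≢ r
next-≢ 0F ()
next-≢ 1F ()
next-≢ 2F ()

next²-≢ : ∀ r → next (next r) ≢ r
next²-≢ 0F ()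
next²-≢ 1F ()
next²-≢ 2F ()

avoid-two : ∀ (r₁ r₂ : Fin 3) → ∃ λ r → r ≢ r₁ × r ≢ r₂
avoid-two 0F 0F = 1F , (λ ()) , (λ ())
avoid-two 0F 1F = 2F , (λ ()) , (λ ())
avoid-two 0F 2F = 1F , (λ ()) , (λ ())
avoid-two 1F 0F = 2F , (λ ()) , (λ ())
avoid-two 1F 1F = 0F , (λ ()) , (λ ())
avoid-two 1F 2F = 0F , (λ ()) , (λ ())
avoid-two 2F 0F = 1F , (λ ()) , (λ ())
avoid-two 2F 1F = 0F , (λ ()) , (λ ())
avoid-two 2F 2F = 0F , (λ ()) , (λ ())

argmin : (f : Fin 3 → ℕ) → ∃ λ r → f r ≤ f (next r) × f r ≤ f (next (next r))
argmin f with ≤-total (f 0F) (f 1F) | ≤-total (f 0F) (f 2F) | ≤-total (f 1F) (f 2F)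
... | inj₁ f₀≤f₁ | inj₁ f₀≤f₂ | _          = 0F , f₀≤f₁ , f₀≤f₂
... | inj₁ f₀≤f₁ | inj₂ f₂≤f₀ | _          = 2F , f₂≤f₀ , ≤-trans f₂≤f₀ f₀≤f₁
... | inj₂ f₁≤f₀ | _          | inj₁ f₁≤f₂ = 1F , f₁≤f₂ , f₁≤f₀
... | inj₂ f₁≤f₀ | _          | inj₂ f₂≤f₁ = 2F , ≤-trans f₂≤f₁ f₁≤f₀ , f₂≤f₁

balanced-constant : ∀ p → Balanced p → ∀ r r′ → pairNimSum p r ≡ pairNimSum p r′
balanced-constant p (e₀₁ , e₁₂) r r′ = trans (to₁ r) (sym (to₁ r′))
  where
  to₁ : ∀ r → pairNimSum p r ≡ pairNimSum p 1F
  to₁ 0F = e₀₁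
  to₁ 1F = refl
  to₁ 2F = sym e₁₂

balanced-rotation : ∀ p r → pairNimSum p r ≡ pairNimSum p (next r) →
                    pairNimSum p (next r) ≡ pairNimSum p (next (next r)) → Balanced p
balanced-rotation _ 0F e₁ e₂ = e₁ , e₂
balanced-rotation _ 1F e₁ e₂ = sym (trans e₁ e₂) , e₁
balanced-rotation _ 2F e₁ e₂ = e₂ , sym (trans e₁ e₂)

window-pairs-differ : ∀ {s} → s ∈ S₁₂ → ∀ i → pair i ≢ pair (i ⊹ s)
window-pairs-differ (here refl) 0F ()
window-pairs-differ (here refl) 1F ()
window-pairs-differ (here refl) 2F ()
window-pairs-differ (here refl) 3F ()
window-pairs-differ (here refl) 4F ()
window-pairs-differ (here refl) 5F ()
window-pairs-differ (there (here refl)) 0F ()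
window-pairs-differ (there (here refl)) 1F ()
window-pairs-differ (there (here refl)) 2F ()
window-pairs-differ (there (here refl)) 3F ()
window-pairs-differ (there (here refl)) 4F ()
window-pairs-differ (there (here refl)) 5F ()

window-pair-injective : ∀ {s i u v} → s ∈ S₁₂ → Window s i u → Window s i v → pair u ≡ pair v → u ≡ v
window-pair-injective _   (inj₁ refl) (inj₁ refl) _ = refl
window-pair-injective _   (inj₂ refl) (inj₂ refl) _ = refl
window-pair-injective {i = i} s∈ (inj₁ refl) (inj₂ refl) eq = contradiction eq (window-pairs-differ s∈ i)
window-pair-injective {i = i} s∈ (inj₂ refl) (inj₁ refl) eq = contradiction (sym eq) (window-pairs-differ s∈ i)

adjacent-pairs-window : ∀ r {w₁ w₂} → InPair r w₁ → InPair (next r) w₂ → ∃₂ λ s i → s ∈ S₁₂ × Window s i w₁ × Window s i w₂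
adjacent-pairs-window 0F lower lower = 1 , 0F , here refl , inj₁ refl , inj₂ refl
adjacent-pairs-window 0F lower upper = 2 , 4F , there (here refl) , inj₂ refl , inj₁ refl
adjacent-pairs-window 0F upper lower = 2 , 1F , there (here refl) , inj₂ refl , inj₁ refl
adjacent-pairs-window 0F upper upper = 1 , 3F , here refl , inj₁ refl , inj₂ refl
adjacent-pairs-window 1F lower lower = 1 , 1F , here refl , inj₁ refl , inj₂ refl
adjacent-pairs-window 1F lower upper = 2 , 5F , there (here refl) , inj₂ refl , inj₁ refl
adjacent-pairs-window 1F upper lower = 2 , 2F , there (here refl) , inj₂ refl , inj₁ refl
adjacent-pairs-window 1F upper upper = 1 , 4F , here refl , inj₁ refl , inj₂ refl
adjacent-pairs-window 2F lower lower = 2 , 0F , there (here refl) , inj₂ refl , inj₁ refl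
adjacent-pairs-window 2F lower upper = 1 , 2F , here refl , inj₁ refl , inj₂ refl
adjacent-pairs-window 2F upper lower = 1 , 5F , here refl , inj₁ refl , inj₂ refl
adjacent-pairs-window 2F upper upper = 2 , 3F , there (here refl) , inj₂ refl , inj₁ refl

balanced-independent : ∀ {p q} → Move 6 S₁₂ 2 p q → Balanced p → ¬ Balanced q
balanced-independent {p} {q} (s , s∈ , i , j , j<2 , _ , fixed , l , ql<pl) balanced-p balanced-q
  with avoid-two (pair i) (pair (i ⊹ s))
... | r , r≢pair-i , r≢pair-i⊹s = <-irrefl (⊕-cancelʳ (p (opposite l)) same-pair-nim-sum) ql<pl
  where
  untouched : ∀ u → ¬ Window s i u → q u ≡ p u
  untouched u u∉ = fixed u (u∉ ∘ affected⇒window j<2)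

  l∈ : Window s i l
  l∈ = decidable-stable (window? s i l) (λ l∉ → <-irrefl (untouched l l∉) ql<pl)

  opposite∉ : ¬ Window s i (opposite l)
  opposite∉ opp∈ = opposite-≢ l (window-pair-injective s∈ opp∈ l∈ (pair-opposite l))

  pair-r∉ : ∀ {u} → InPair r u → ¬ Window s i u
  pair-r∉ u∈ (inj₁ refl) = r≢pair-i (sym (InPair⇒pair u∈))
  pair-r∉ u∈ (inj₂ refl) = r≢pair-i⊹s (sym (InPair⇒pair u∈))

  same-pair-nim-sum : q l ⊕ p (opposite l) ≡ p l ⊕ p (opposite l)
  same-pair-nim-sum = begin
    q l ⊕ p (opposite l)     ≡⟨ cong (q l ⊕_) (untouched (opposite l) opposite∉) ⟨
    q l ⊕ q (opposite l)     ≡⟨ pairNimSum-InPair q (inPair l) ⟨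
    pairNimSum q (pair l)    ≡⟨ balanced-constant q balanced-q (pair l) r ⟩
    pairNimSum q r           ≡⟨ cong₂ _⊕_ (untouched _ (pair-r∉ lower)) (untouched _ (pair-r∉ upper)) ⟩
    pairNimSum p r           ≡⟨ balanced-constant p balanced-p r (pair l) ⟩
    pairNimSum p (pair l)    ≡⟨ pairNimSum-InPair p (inPair l) ⟩
    p l ⊕ p (opposite l)     ∎

record PairAdjustment (p : Position 6) (r : Fin 3) (t : ℕ) : Set where
  constructor adjustment
  field
    pile     : Fin 6
    pile∈    : InPair r pile
    height   : ℕ
    height≤  : height ≤ p pile
    nim-sum  : height ⊕ p (opposite pile) ≡ t
    height<  : t < pairNimSum p r → height < p pile

adjust-pair : ∀ p r {t} → t ≤ pairNimSum p r → PairAdjustment p r t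
adjust-pair p r {t} t≤ with m≤n⇒m<n∨m≡n t≤
... | inj₂ t≡ = adjustment (r ↑ˡ 3) lower (p (r ↑ˡ 3)) ≤-refl (sym t≡) (λ t< → contradiction t≡ (<⇒≢ t<))
... | inj₁ t< with ⊕-lowering (p (r ↑ˡ 3)) (p (opposite (r ↑ˡ 3))) t t<
...   | inj₁ (x′ , x′< , x′⊕≡t) = adjustment (r ↑ˡ 3) lower x′ (<⇒≤ x′<) x′⊕≡t (const x′<)
...   | inj₂ (y′ , y′< , y′⊕≡t) = adjustment (opposite (r ↑ˡ 3)) upper y′ (<⇒≤ y′<)
        (subst (λ v → y′ ⊕ p v ≡ t) (sym (opposite-involutive (r ↑ˡ 3))) y′⊕≡t) (const y′<)

balanced-absorbing : ∀ p → ¬ Balanced p → ∃ λ q → Move 6 S₁₂ 2 p q × Balanced q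
balanced-absorbing p unbalanced with argmin (pairNimSum p)
... | r , t≤₁ , t≤₂
  with adjust-pair p (next r) t≤₁ | adjust-pair p (next (next r)) t≤₂
... | adjustment w₁ w₁∈ z₁ z₁≤ nim₁ strict₁ | adjustment w₂ w₂∈ z₂ z₂≤ nim₂ strict₂
  with adjacent-pairs-window (next r) w₁∈ w₂∈
... | s , i , s∈ , w₁∈W , w₂∈W = updated , move , balanced-rotation updated r (trans pair₀ (sym pair₁)) (trans pair₁ (sym pair₂))
  where
  t = pairNimSum p r
  w₁≢w₂ : w₁ ≢ w₂
  w₁≢w₂ = InPair-apart w₁∈ w₂∈ (≢-sym (next-≢ (next r)))
  open TwoPileUpdate p w₁≢w₂ z₁ z₂

  decrease : z₁ < p w₁ ⊎ z₂ < p w₂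
  decrease with m≤n⇒m<n∨m≡n t≤₁ | m≤n⇒m<n∨m≡n t≤₂
  ... | inj₁ t<₁ | _        = inj₁ (strict₁ t<₁)
  ... | inj₂ _   | inj₁ t<₂ = inj₂ (strict₂ t<₂)
  ... | inj₂ t≡₁ | inj₂ t≡₂ = contradiction (balanced-rotation p r t≡₁ (trans (sym t≡₁) t≡₂)) unbalanced

  move : Move 6 S₁₂ 2 p updated
  move = two-pile-move {i = i} w₁≢w₂ s∈ (s≤s (s≤s z≤n)) (window⇒affected w₁∈W) (window⇒affected w₂∈W) z₁≤ z₂≤ decrease

  untouched : ∀ {u} → InPair r u → updated u ≡ p u
  untouched u∈ = updated-elsewhere (InPair-apart u∈ w₁∈ (≢-sym (next-≢ r))) (InPair-apart u∈ w₂∈ (≢-sym (next²-≢ r)))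

  pair₀ : pairNimSum updated r ≡ t
  pair₀ = cong₂ _⊕_ (untouched lower) (untouched upper)

  adjusted : ∀ {r′ w z} → InPair r′ w → updated w ≡ z → updated (opposite w) ≡ p (opposite w) →
             z ⊕ p (opposite w) ≡ t → pairNimSum updated r′ ≡ t
  adjusted w∈ updated-w updated-opposite nim =
    trans (pairNimSum-InPair updated w∈) (trans (cong₂ _⊕_ updated-w updated-opposite) nim)

  pair₁ : pairNimSum updated (next r) ≡ t
  pair₁ = adjusted w₁∈ updated-w₁
    (updated-elsewhere (opposite-≢ w₁) (InPair-apart (InPair-opposite w₁∈) w₂∈ (≢-sym (next-≢ (next r))))) nim₁

  pair₂ : pairNimSum updated (next (next r)) ≡ t
  pair₂ = adjusted w₂∈ updated-w₂
    (updated-elsewhere (InPair-apart (InPair-opposite w₂∈) w₁∈ (next-≢ (next r))) (opposite-≢ w₂)) nim₂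

mainTheorem2 : (n₀ n₁ n₂ n₃ n₄ n₅ : ℕ) →
    IsP 6 (1 ∷ 2 ∷ []) 2 (lookup (n₀ ∷ n₁ ∷ n₂ ∷ n₃ ∷ n₄ ∷ n₅ ∷ []))
      ⇔ ((n₀ ⊕ n₃ ≡ n₁ ⊕ n₄) × (n₁ ⊕ n₄ ≡ n₂ ⊕ n₅))
mainTheorem2 n₀ n₁ n₂ n₃ n₄ n₅ =
  IsP⇔kernel Balanced balanced? balanced-independent balanced-absorbing _
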